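{- Every $321$-avoiding permutation of size $k$ has a stair-decomposition with at most $k$ blocks.
   Context: For a permutation $\pi$ of size $k$, its elements are the values $1,\dots,k$; an element $x$ is above $y$ if $x>y$, and $x$ is left of $y$ if $x$ occurs before $y$ in $\pi$. For sets $X,Y$ of elements, $X$ is above (resp. to the right of) $Y$ if every element of $X$ is above (resp. to the right of) every element of $Y$ (vacuous if a set is empty). A stair-decomposition of a $321$-avoiding permutation $\pi$ of size $k$ is a partition of $[k]$ into possibly empty subsets $B_1,\dots,B_m$ (the blocks) such that: each $B_i$ forms an increasing subsequence of $\pi$; $B_{2i}$ is above $B_{2i-1}$ for each $i\le\lfloor m/2\rfloor$; $B_{2i+1}$ is to the right of $B_{2i}$ for each $i\le\lceil m/2\rceil-1$; and $B_{i+2}$ is above and to the right of $B_i$ for each $i\le m-2$. -}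

module Defs where

open import Data.Nat using (ℕ; _+_; _*_)
open import Data.Fin using (Fin; toℕ; _<_)
open import Data.Fin.Permutation using (Permutation′; _⟨$⟩ʳ_; _⟨$⟩ˡ_)
open import Data.Product using (_×_)
open import Relation.Binary.PropositionalEquality using (_≡_)
open import Relation.Nullary using (¬_)

-- A permutation of size k: π ⟨$⟩ʳ p is the value (element) at position p,
-- π ⟨$⟩ˡ x is the position of element x.  Elements/positions are Fin k
-- (i.e. 0-based; only the order matters).

pos : ∀ {k} → Permutation′ k → Fin k → Fin k
pos π x = π ⟨$⟩ˡ x

LeftOf : ∀ {k} → Permutation′ k → Fin k → Fin k → Set
LeftOf π x y = pos π x < pos π y

Avoids321 : ∀ {k} → Permutation′ k → Set
Avoids321 {k} π = ∀ (p q r : Fin k) → p < q → q < r →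
  ¬ ((π ⟨$⟩ʳ q < π ⟨$⟩ʳ p) × (π ⟨$⟩ʳ r < π ⟨$⟩ʳ q))

-- A stair-decomposition into m blocks, given as the block-assignment
-- b : Fin k → Fin m (element x lies in block B_{toℕ (b x) + 1} of the paper;
-- blocks are 0-indexed here, possibly empty).
record IsStairDecomposition {k m : ℕ} (π : Permutation′ k) (b : Fin k → Fin m) : Set where
  field
    increasing : ∀ x y → b x ≡ b y → x < y → LeftOf π x y
    -- B_{2i} above B_{2i-1}  (0-indexed: block 2j+1 above block 2j)
    above : ∀ (j : ℕ) x y → toℕ (b x) ≡ 2 * j → toℕ (b y) ≡ 2 * j + 1 → x < y
    -- B_{2i+1} right of B_{2i}  (0-indexed: block 2j+2 right of block 2j+1)
    right : ∀ (j : ℕ) x y → toℕ (b x) ≡ 2 * j + 1 → toℕ (b y) ≡ 2 * j + 2 → LeftOf π x y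
    stair : ∀ x y → toℕ (b y) ≡ toℕ (b x) + 2 → (x < y) × LeftOf π x y

module Submission where

-- Label every element x by whether some smaller element occurs to its right
-- (x is "labelled") or not (x is a right-to-left minimum).  If π avoids 321,
-- then for x < y the element x lies left of y whenever y is unlabelled or x
-- is labelled; only "x labelled, y unlabelled" may be out of order.
--
-- Cut the values 0 < 1 < … < k-1 into maximal runs of equal label.  The run
-- index of an element never exceeds its value, runs are ordered by value,
-- labels alternate from run to run, and run 0 is unlabelled (the element 0
-- is a right-to-left minimum).  These facts, together with the order
-- property above, are exactly the stair conditions when even runs are the
-- blocks B₁, B₃, … and odd runs the blocks B₂, B₄, ….

open import Defs
open import Data.Nat using (ℕ; _≤_)
open import Data.Fin using (Fin)
open import Data.Fin.Permutation using (Permutation′)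
open import Data.Product using (Σ; _×_)

open import Data.Nat as ℕ using (zero; suc; _+_; _*_; z≤n; z<s; s<s)
open import Data.Nat.Properties as ℕ
  using (≤-refl; ≤-trans; ≤-<-trans; ≤-antisym; m≤n⇒m≤1+n; n≤1+n; ≰⇒>; ≮⇒≥; <⇒≱; m<m+n; *-suc; n≮0)
open import Data.Fin using (toℕ; fromℕ<; _<_)
open import Data.Fin.Properties using (any?; _<?_; <-cmp; <⇒≢; toℕ<n; toℕ-fromℕ<; fromℕ<-toℕ)
open import Data.Fin.Permutation using (_⟨$⟩ʳ_; inverseʳ)
open import Data.Bool using (Bool; true; false; not; _≟_)
open import Data.Bool.Properties using (not-involutive; ¬-not)
open import Data.Product using (_,_; ∃)
open import Data.Sum using (_⊎_; inj₁; inj₂)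
open import Data.Empty using (⊥-elim)
open import Function using (_∘_)
open import Relation.Nullary using (¬_; Dec; yes; no; does; contradiction)
open import Relation.Nullary.Decidable using (_×-dec_; dec-false)
open import Relation.Binary using (tri<; tri≈; tri>)
open import Relation.Binary.PropositionalEquality
  using (_≡_; _≢_; refl; sym; trans; cong; cong₂; subst; subst₂; module ≡-Reasoning)

true-witness : ∀ {A : Set} (a? : Dec A) → does a? ≡ true → A
true-witness (yes a) _ = a

false-witness : ∀ {A : Set} (a? : Dec A) → does a? ≡ false → ¬ A
false-witness (no ¬a) _ = ¬a

-- alternate b n is b negated n times: the label of run n when run 0 has label b.
alternate : Bool → ℕ → Bool
alternate b zero    = b
alternate b (suc n) = not (alternate b n)

alternate-+2 : ∀ b n → alternate b (n + 2) ≡ alternate b n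
alternate-+2 b zero    = not-involutive b
alternate-+2 b (suc n) = cong not (alternate-+2 b n)

alternate-even : ∀ b j → alternate b (2 * j) ≡ b
alternate-even b zero    = refl
alternate-even b (suc j) = begin
  alternate b (2 * suc j)         ≡⟨ cong (alternate b) (*-suc 2 j) ⟩
  not (not (alternate b (2 * j))) ≡⟨ not-involutive _ ⟩
  alternate b (2 * j)             ≡⟨ alternate-even b j ⟩
  b                               ∎
  where open ≡-Reasoning

module Runs (f : ℕ → Bool) where

  -- runIndex n counts the label changes among f 0, f 1, …, f n, i.e. it is the
  -- index of the maximal constant run containing n.
  runIndex : ℕ → ℕ
  runIndex zero = zero
  runIndex (suc n) with f n ≟ f (suc n)
  ... | yes _ = runIndex n
  ... | no  _ = suc (runIndex n)

  runIndex-≤ : ∀ n → runIndex n ≤ n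
  runIndex-≤ zero = z≤n
  runIndex-≤ (suc n) with f n ≟ f (suc n)
  ... | yes _ = m≤n⇒m≤1+n (runIndex-≤ n)
  ... | no  _ = ℕ.s≤s (runIndex-≤ n)

  runIndex-step : ∀ n → runIndex n ≤ runIndex (suc n)
  runIndex-step n with f n ≟ f (suc n)
  ... | yes _ = ≤-refl
  ... | no  _ = n≤1+n _

  runIndex-mono : ∀ {m n} → m ≤ n → runIndex m ≤ runIndex n
  runIndex-mono {n = zero} z≤n = ≤-refl
  runIndex-mono {m} {suc n} m≤1+n with m ℕ.≤? n
  ... | yes m≤n = ≤-trans (runIndex-mono m≤n) (runIndex-step n)
  ... | no  m≰n rewrite ≤-antisym m≤1+n (≰⇒> m≰n) = ≤-refl

  runIndex-reflects-< : ∀ {m n} → runIndex m ℕ.< runIndex n → m ℕ.< n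
  runIndex-reflects-< {m} {n} lt with m ℕ.<? n
  ... | yes m<n = m<n
  ... | no  m≮n = contradiction (runIndex-mono (≮⇒≥ m≮n)) (<⇒≱ lt)

  label-alternates : ∀ n → f n ≡ alternate (f 0) (runIndex n)
  label-alternates zero = refl
  label-alternates (suc n) with f n ≟ f (suc n)
  ... | yes same = trans (sym same) (label-alternates n)
  ... | no  diff = trans (¬-not (diff ∘ sym)) (cong not (label-alternates n))

record StairLabelling {k : ℕ} (π : Permutation′ k) (ℓ : Fin k → Bool) : Set where
  field
    minimum-unlabelled : ∀ x → toℕ x ≡ 0 → ℓ x ≡ false
    leftOf-unlabelled  : ∀ x y → x < y → ℓ y ≡ false → LeftOf π x y
    leftOf-labelled    : ∀ x y → x < y → ℓ x ≡ true → LeftOf π x y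

  leftOf-same-label : ∀ x y → ℓ x ≡ ℓ y → x < y → LeftOf π x y
  leftOf-same-label x y same x<y with ℓ y in ℓy
  ... | false = leftOf-unlabelled x y x<y ℓy
  ... | true  = leftOf-labelled x y x<y same

module _ {k : ℕ} (ℓ : Fin k → Bool) where

  -- The labelling as a sequence on ℕ, padded with false beyond k.
  labelSeq : ℕ → Bool
  labelSeq n with n ℕ.<? k
  ... | yes n<k = ℓ (fromℕ< n<k)
  ... | no  _   = false

  labelSeq-toℕ : ∀ x → labelSeq (toℕ x) ≡ ℓ x
  labelSeq-toℕ x with toℕ x ℕ.<? k
  ... | yes x<k = cong ℓ (fromℕ<-toℕ x x<k)
  ... | no  x≮k = contradiction (toℕ<n x) x≮k

  labelSeq-0 : (∀ x → toℕ x ≡ 0 → ℓ x ≡ false) → labelSeq 0 ≡ false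
  labelSeq-0 min with 0 ℕ.<? k
  ... | yes 0<k = min (fromℕ< 0<k) (toℕ-fromℕ< 0<k)
  ... | no  _   = refl

  open Runs labelSeq

  runBlock : Fin k → Fin k
  runBlock x = fromℕ< (≤-<-trans (runIndex-≤ (toℕ x)) (toℕ<n x))

  toℕ-runBlock : ∀ x → toℕ (runBlock x) ≡ runIndex (toℕ x)
  toℕ-runBlock x = toℕ-fromℕ< _

  runBlock-ordered : ∀ {x y i j} → toℕ (runBlock x) ≡ i → toℕ (runBlock y) ≡ j →
                     i ℕ.< j → x < y
  runBlock-ordered {x} {y} refl refl i<j =
    runIndex-reflects-< (subst₂ ℕ._<_ (toℕ-runBlock x) (toℕ-runBlock y) i<j)

  runs-stairDecomposition : ∀ {π : Permutation′ k} → StairLabelling π ℓ →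
                            IsStairDecomposition π runBlock
  runs-stairDecomposition sl = record
    { increasing = λ x y same x<y →
        leftOf-same-label x y
          (trans (blockLabel x) (trans (cong (alternate false ∘ toℕ) same) (sym (blockLabel y))))
          x<y
    ; above = λ j x y ex ey → runBlock-ordered ex ey (m<m+n (2 * j) z<s)
    ; right = λ j x y ex ey →
        leftOf-unlabelled x y (runBlock-ordered ex ey (ℕ.+-monoʳ-< (2 * j) (s<s z<s)))
          (trans (blockLabel y) (trans (cong (alternate false) ey) (evenLabel j)))
    ; stair = λ x y e →
        let x<y = runBlock-ordered refl e (m<m+n (toℕ (runBlock x)) z<s)
        in x<y , leftOf-same-label x y
                   (trans (blockLabel x) (trans (sym (alternate-+2 false (toℕ (runBlock x))))
                     (trans (cong (alternate false) (sym e)) (sym (blockLabel y)))))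
                   x<y
    }
    where
    open StairLabelling sl

    blockLabel : ∀ x → ℓ x ≡ alternate false (toℕ (runBlock x))
    blockLabel x = begin
      ℓ x                                     ≡⟨ sym (labelSeq-toℕ x) ⟩
      labelSeq (toℕ x)                        ≡⟨ label-alternates (toℕ x) ⟩
      alternate (labelSeq 0) (runIndex (toℕ x)) ≡⟨ cong₂ alternate (labelSeq-0 minimum-unlabelled) (sym (toℕ-runBlock x)) ⟩
      alternate false (toℕ (runBlock x))      ∎
      where open ≡-Reasoning

    evenLabel : ∀ j → alternate false (2 * j + 2) ≡ false
    evenLabel j = trans (alternate-+2 false (2 * j)) (alternate-even false j)

module _ {k : ℕ} (π : Permutation′ k) where

  LaterSmaller : Fin k → Fin k → Set
  LaterSmaller x q = pos π x < q × π ⟨$⟩ʳ q < x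

  laterSmaller? : ∀ x → Dec (∃ (LaterSmaller x))
  laterSmaller? x = any? (λ q → (pos π x <? q) ×-dec (π ⟨$⟩ʳ q <? x))

  hasLaterSmaller : Fin k → Bool
  hasLaterSmaller x = does (laterSmaller? x)

  value-at-pos : ∀ x → π ⟨$⟩ʳ pos π x ≡ x
  value-at-pos x = inverseʳ π

  -- Distinct elements occupy distinct positions.
  leftOf-or-rightOf : ∀ {x y} → x ≢ y → LeftOf π x y ⊎ LeftOf π y x
  leftOf-or-rightOf {x} {y} x≢y with <-cmp (pos π x) (pos π y)
  ... | tri< left _ _ = inj₁ left
  ... | tri≈ _ same _ =
        contradiction (trans (sym (value-at-pos x)) (trans (cong (π ⟨$⟩ʳ_) same) (value-at-pos y))) x≢y
  ... | tri> _ _ right = inj₂ right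

  leftOf-rlMinimum : ∀ x y → ¬ ∃ (LaterSmaller y) → x < y → LeftOf π x y
  leftOf-rlMinimum x y ymin x<y with leftOf-or-rightOf (<⇒≢ x<y)
  ... | inj₁ left  = left
  ... | inj₂ right = ⊥-elim (ymin (pos π x , right , subst (_< y) (sym (value-at-pos x)) x<y))

  -- An element followed by a smaller one lies left of every larger element,
  -- since otherwise the three would form a 321 pattern.
  leftOf-laterSmaller : Avoids321 π → ∀ x y → ∃ (LaterSmaller x) → x < y → LeftOf π x y
  leftOf-laterSmaller av x y (r , x-left-of-r , r<x) x<y with leftOf-or-rightOf (<⇒≢ x<y)
  ... | inj₁ left  = left
  ... | inj₂ right = ⊥-elim (av (pos π y) (pos π x) r right x-left-of-r
          ( subst₂ _<_ (sym (value-at-pos x)) (sym (value-at-pos y)) x<y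
          , subst (π ⟨$⟩ʳ r <_) (sym (value-at-pos x)) r<x ))

  laterSmaller-stairLabelling : Avoids321 π → StairLabelling π hasLaterSmaller
  laterSmaller-stairLabelling av = record
    { minimum-unlabelled = λ x x≡0 → dec-false (laterSmaller? x)
        (λ { (q , _ , q<x) → n≮0 (subst (toℕ (π ⟨$⟩ʳ q) ℕ.<_) x≡0 q<x) })
    ; leftOf-unlabelled = λ x y x<y ℓy →
        leftOf-rlMinimum x y (false-witness (laterSmaller? y) ℓy) x<y
    ; leftOf-labelled = λ x y x<y ℓx →
        leftOf-laterSmaller av x y (true-witness (laterSmaller? x) ℓx) x<y
    }

lemma2 : ∀ (k : ℕ) (π : Permutation′ k) → Avoids321 π →
    Σ ℕ (λ m → m ≤ k × Σ (Fin k → Fin m) (λ b → IsStairDecomposition π b))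
lemma2 k π av =
  k , ≤-refl , runBlock (hasLaterSmaller π) ,
  runs-stairDecomposition (hasLaterSmaller π) (laterSmaller-stairLabelling π av)
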